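{- Let $F(n)$ denote the Fibonacci numbers ($F(0)=0$, $F(1)=1$, $F(n)=F(n-1)+F(n-2)$, extended to all integers by the recurrence) and let $f(n)=\sum_{j=0}^{n-1}F(j)^2F(2n-j)$ for $n\ge0$. (i) The functions $nF(2n)$, $F(2n)$, $nF(2n+1)$, $F(2n+1)$, $F(n)^3$, $F(n)^2F(n+1)$, $F(n)F(n+1)^2$, $F(n+1)^3$ are linearly independent on $\{0,1,2,\dots\}$, and the unique expression of $f(n)$ as their linear combination is $$f(n)=\tfrac12\big(F(2n)+F(n)^2F(n+1)-F(n)F(n+1)^2+F(n+1)^3-F(2n+1)\big).$$ (ii) The functions $F(n)^3$, $F(n)^2F(n+1)$, $F(n)F(n+1)^2$, $F(n+1)^3$, $F(n)^2$, $F(n)F(n+1)$, $F(n+1)^2$, $nF(n)^2$, $nF(n)F(n+1)$, $nF(n+1)^2$ are linearly independent, and the unique expression of $f(n)$ as their linear combination is $$f(n)=\tfrac12\big(2F(n)F(n+1)-2F(n)^2-F(n+1)^2+F(n)^2F(n+1)-F(n)F(n+1)^2+F(n+1)^3\big).$$ -}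

module Defs where

open import Data.Nat as ℕ using (ℕ; zero; suc)
open import Data.Fin using (Fin; zero; suc; toℕ)
open import Data.Rational using (ℚ; 0ℚ; _+_; _*_; -_; _/_)
open import Relation.Binary.PropositionalEquality using (_≡_)

infixr 8 _^_
_^_ : ℚ → ℕ → ℚ
x ^ zero = Data.Rational.1ℚ
x ^ suc k = x * (x ^ k)

-- Fibonacci numbers on ℕ, as rationals (only nonnegative indices are needed)
fib : ℕ → ℚ
fib 0 = 0ℚ
fib 1 = Data.Rational.1ℚ
fib (suc (suc n)) = fib (suc n) + fib n

nℚ : ℕ → ℚ
nℚ n = Data.Rational.mkℚ+ n 1 (Data.Nat.Coprimality.sym (Data.Nat.Coprimality.1-coprimeTo n))
  where import Data.Nat.Coprimality

Σ< : (k : ℕ) → (Fin k → ℚ) → ℚ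
Σ< zero g = 0ℚ
Σ< (suc k) g = g zero + Σ< k (λ i → g (suc i))

f : ℕ → ℚ
f n = Σ< n (λ j → (fib (toℕ j) ^ 2) * fib ((2 ℕ.* n) ℕ.∸ toℕ j))

lincomb : {k : ℕ} → (Fin k → ℚ) → (Fin k → ℕ → ℚ) → ℕ → ℚ
lincomb {k} c g n = Σ< k (λ i → c i * g i n)

LinIndep : {k : ℕ} → (Fin k → ℕ → ℚ) → Set
LinIndep {k} g = (c : Fin k → ℚ) → (∀ n → lincomb c g n ≡ 0ℚ) → ∀ i → c i ≡ 0ℚ

UniqueExpr : {k : ℕ} → (Fin k → ℕ → ℚ) → (ℕ → ℚ) → (Fin k → ℚ) → Set
UniqueExpr {k} g h c =
  (∀ n → h n ≡ lincomb c g n) ×' ((d : Fin k → ℚ) → (∀ n → h n ≡ lincomb d g n) → ∀ i → d i ≡ c i)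
  where open import Data.Product renaming (_×_ to _×'_)

family1 : Fin 8 → ℕ → ℚ
family1 zero n = nℚ n * fib (2 ℕ.* n)
family1 (suc zero) n = fib (2 ℕ.* n)
family1 (suc (suc zero)) n = nℚ n * fib (suc (2 ℕ.* n))
family1 (suc (suc (suc zero))) n = fib (suc (2 ℕ.* n))
family1 (suc (suc (suc (suc zero)))) n = fib n ^ 3
family1 (suc (suc (suc (suc (suc zero))))) n = (fib n ^ 2) * fib (suc n)
family1 (suc (suc (suc (suc (suc (suc zero)))))) n = fib n * (fib (suc n) ^ 2)
family1 (suc (suc (suc (suc (suc (suc (suc zero))))))) n = fib (suc n) ^ 3

half : ℚ
half = Data.Rational.½

coeffs1 : Fin 8 → ℚ
coeffs1 zero = 0ℚ
coeffs1 (suc zero) = half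
coeffs1 (suc (suc zero)) = 0ℚ
coeffs1 (suc (suc (suc zero))) = - half
coeffs1 (suc (suc (suc (suc zero)))) = 0ℚ
coeffs1 (suc (suc (suc (suc (suc zero))))) = half
coeffs1 (suc (suc (suc (suc (suc (suc zero)))))) = - half
coeffs1 (suc (suc (suc (suc (suc (suc (suc zero))))))) = half

family2 : Fin 10 → ℕ → ℚ
family2 zero n = fib n ^ 3
family2 (suc zero) n = (fib n ^ 2) * fib (suc n)
family2 (suc (suc zero)) n = fib n * (fib (suc n) ^ 2)
family2 (suc (suc (suc zero))) n = fib (suc n) ^ 3
family2 (suc (suc (suc (suc zero)))) n = fib n ^ 2
family2 (suc (suc (suc (suc (suc zero))))) n = fib n * fib (suc n)
family2 (suc (suc (suc (suc (suc (suc zero)))))) n = fib (suc n) ^ 2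
family2 (suc (suc (suc (suc (suc (suc (suc zero))))))) n = nℚ n * (fib n ^ 2)
family2 (suc (suc (suc (suc (suc (suc (suc (suc zero)))))))) n = nℚ n * (fib n * fib (suc n))
family2 (suc (suc (suc (suc (suc (suc (suc (suc (suc zero))))))))) n = nℚ n * (fib (suc n) ^ 2)

coeffs2 : Fin 10 → ℚ
coeffs2 zero = 0ℚ
coeffs2 (suc zero) = half
coeffs2 (suc (suc zero)) = - half
coeffs2 (suc (suc (suc zero))) = half
coeffs2 (suc (suc (suc (suc zero)))) = - Data.Rational.1ℚ
coeffs2 (suc (suc (suc (suc (suc zero))))) = Data.Rational.1ℚ
coeffs2 (suc (suc (suc (suc (suc (suc zero)))))) = - half
coeffs2 (suc (suc (suc (suc (suc (suc (suc zero))))))) = 0ℚ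
coeffs2 (suc (suc (suc (suc (suc (suc (suc (suc zero)))))))) = 0ℚ
coeffs2 (suc (suc (suc (suc (suc (suc (suc (suc (suc zero))))))))) = 0ℚ

{-# OPTIONS --safe #-}
-- Put C m k = Σ_{j<k} F(j)² F(m+k−j), so that f(n) = C n n.  In m, C m k obeys the
-- Fibonacci recurrence, and splitting off the last summand gives
-- C m (k+1) = C (m+1) k + F(k)² F(m+1).  Hence the pair (C n n, C (n+1) n) satisfies a
-- linear recurrence driven by F(n)², and induction shows that both are cubic polynomials
-- in F(n), F(n+1); the first one is formula (ii), and the doubling formulas for F(2n),
-- F(2n+1) turn it into formula (i).  Each family is linearly independent because its
-- matrix of values at n = 0, …, k−1 has an explicit inverse, which is checked by
-- evaluation; uniqueness of the coefficients follows.
module Submission where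

open import Agda.Builtin.FromNat using (Number)
open import Agda.Builtin.FromNeg using (Negative)
open import Algebra.Bundles using (Ring)
open import Algebra.Bundles.Raw using (RawRing)
open import Data.Fin using (Fin; zero; suc; toℕ; inject₁; fromℕ)
import Data.Fin.Properties as Fin
open import Data.Integer using (ℤ)
import Data.Integer.Literals as ℤ
open import Data.Nat as ℕ using (ℕ; zero; suc)
import Data.Nat.Literals as ℕ
import Data.Nat.Properties as ℕ
open import Data.Product using (_×_; _,_; proj₁; proj₂)
import Data.Rational as ℚ
open import Data.Rational using (ℚ; 0ℚ; 1ℚ; ½; _/_)
import Data.Rational.Literals as ℚ
open import Data.Rational.Properties
  using (_≟_; +-0-group; +-*-ring; *-distribˡ-+; +-inverseʳ; +-identityˡ; +-identityʳ; *-identityʳ; *-zeroʳ)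
open import Data.Rational.Solver using (module +-*-Solver)
open import Data.Vec using (Vec; _∷_; []; lookup)
open import Function using (_∘_; id)
open import Level using (0ℓ)
open import Relation.Binary.PropositionalEquality
open import Relation.Nullary using (Dec)
open import Relation.Nullary.Decidable using (from-yes)

open import Algebra.Properties.Group +-0-group using (x∙y⁻¹≈ε⇒x≈y)
open import Algebra.Properties.Semiring.Sum (Ring.semiring +-*-ring)
  using (sum-syntax; sum-cong-≗; sum-init-last; ∑-distrib-+; ∑-comm; *-distribˡ-sum;
         sum-replicate-zero)
open +-*-Solver using (solve; _:=_; _:+_; _:*_; _:-_; :-_; con; Polynomial)

open import Defs

-- The cubic forms of the argument, written once over a raw ring so that they serve both as
-- functions on ℚ and as ring-solver syntax.
module Forms (R : RawRing 0ℓ 0ℓ) (κ : ℚ → RawRing.Carrier R) where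

  open RawRing R

  -- Literals are overloaded only here and in LeftInverses: solve needs its arity to be a
  -- plain ℕ literal.
  open import Agda.Builtin.FromNat using (fromNat)
  open import Data.Unit using (tt)

  instance
    ℚ-number : Number ℚ
    ℚ-number = ℚ.number

  infixl 6 _-_
  infix 9 _² _³

  private
    _-_ : Carrier → Carrier → Carrier
    x - y = x + - y

  -- The shape of Defs._^_, so that x ² and fib n ^ 2 agree definitionally.
  _² _³ : Carrier → Carrier
  x ² = x * (x * κ 1ℚ)
  x ³ = x * x ²

  fib-2n-form fib-2n+1-form : Carrier → Carrier → Carrier
  fib-2n-form   x y = κ 2 * x * y - x ²
  fib-2n+1-form x y = x ² + y ²

  f-form f⁺-form : Carrier → Carrier → Carrier
  f-form  x y = κ ½ * (κ 2 * x * y - κ 2 * x ² - y ² + x ² * y - x * y ² + y ³)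
  f⁺-form x y = κ ½ * (x ² + κ 3 * x * y ² - x ² * y - x ³ - κ 2 * x * y)

  -- lincomb coeffs1 family1 n and lincomb coeffs2 family2 n unfold to these at
  -- x = F n, y = F (n+1), t = n, u = F (2n), v = F (2n+1).
  combination₁ : Carrier → Carrier → Carrier → Carrier → Carrier → Carrier
  combination₁ x y t u v =
    κ 0ℚ * (t * u) + (κ ½ * u + (κ 0ℚ * (t * v) + (- κ ½ * v + (κ 0ℚ * x ³
    + (κ ½ * (x ² * y) + (- κ ½ * (x * y ²) + (κ ½ * y ³ + κ 0ℚ)))))))

  combination₂ : Carrier → Carrier → Carrier → Carrier
  combination₂ x y t =
    κ 0ℚ * x ³ + (κ ½ * (x ² * y) + (- κ ½ * (x * y ²) + (κ ½ * y ³
    + (- κ 1ℚ * x ² + (κ 1ℚ * (x * y) + (- κ ½ * y ²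
    + (κ 0ℚ * (t * x ²) + (κ 0ℚ * (t * (x * y)) + (κ 0ℚ * (t * y ²) + κ 0ℚ)))))))))

open Forms ℚ.+-*-rawRing id

polynomial-rawRing : ℕ → RawRing 0ℓ 0ℓ
polynomial-rawRing n = record
  { Carrier = Polynomial n
  ; _≈_     = _≡_
  ; _+_     = _:+_
  ; _*_     = _:*_
  ; -_      = :-_
  ; 0#      = con 0ℚ
  ; 1#      = con 1ℚ
  }

module Poly {n : ℕ} = Forms (polynomial-rawRing n) con

-- Opened only now, since inside Forms these names are the raw ring's operations.
open import Data.Rational using (_+_; _*_; -_; _-_)

Σ<≡∑ : ∀ k (g : Fin k → ℚ) → Σ< k g ≡ ∑[ i < k ] g i
Σ<≡∑ zero    g = refl
Σ<≡∑ (suc k) g = cong (g zero +_) (Σ<≡∑ k (g ∘ suc))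

lincomb-sub : ∀ {k} (c d : Fin k → ℚ) (g : Fin k → ℕ → ℚ) n →
              lincomb (λ i → c i - d i) g n ≡ lincomb c g n - lincomb d g n
lincomb-sub {zero}  c d g n = refl
lincomb-sub {suc k} c d g n = begin
    (c₀ - d₀) * g₀ + lincomb (λ i → c (suc i) - d (suc i)) (g ∘ suc) n  ≡⟨ cong ((c₀ - d₀) * g₀ +_) ih ⟩
    (c₀ - d₀) * g₀ + (∑c - ∑d)                                        ≡⟨ distrib c₀ d₀ g₀ ∑c ∑d ⟩
    (c₀ * g₀ + ∑c) - (d₀ * g₀ + ∑d)                                   ∎
  where
  open ≡-Reasoning
  c₀ = c zero
  d₀ = d zero
  g₀ = g zero n
  ∑c = lincomb (c ∘ suc) (g ∘ suc) n
  ∑d = lincomb (d ∘ suc) (g ∘ suc) n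
  ih = lincomb-sub (c ∘ suc) (d ∘ suc) (g ∘ suc) n
  distrib : ∀ a b x p q → (a - b) * x + (p - q) ≡ (a * x + p) - (b * x + q)
  distrib = solve 5 (λ a b x p q → (a :- b) :* x :+ (p :- q) := (a :* x :+ p) :- (b :* x :+ q)) refl

lincomb-injective : ∀ {k} {g : Fin k → ℕ → ℚ} → LinIndep g → ∀ {c d} →
                    (∀ n → lincomb c g n ≡ lincomb d g n) → ∀ i → c i ≡ d i
lincomb-injective {g = g} indep {c} {d} c≡d i =
  x∙y⁻¹≈ε⇒x≈y (c i) (d i) (indep (λ i → c i - d i) difference≡0 i)
  where
  difference≡0 : ∀ n → lincomb (λ i → c i - d i) g n ≡ 0ℚ
  difference≡0 n = begin
    lincomb (λ i → c i - d i) g n   ≡⟨ lincomb-sub c d g n ⟩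
    lincomb c g n - lincomb d g n   ≡⟨ cong (_- lincomb d g n) (c≡d n) ⟩
    lincomb d g n - lincomb d g n   ≡⟨ +-inverseʳ (lincomb d g n) ⟩
    0ℚ                              ∎
    where open ≡-Reasoning

linIndep⇒uniqueExpr : ∀ {k} (g : Fin k → ℕ → ℚ) {h c} → LinIndep g →
                      (∀ n → h n ≡ lincomb c g n) → UniqueExpr g h c
linIndep⇒uniqueExpr g indep h≡c =
  h≡c , λ d h≡d → lincomb-injective indep (λ n → trans (sym (h≡d n)) (h≡c n))

δ : ∀ {k} → Fin k → Fin k → ℚ
δ zero    zero    = 1ℚ
δ zero    (suc _) = 0ℚ
δ (suc _) zero    = 0ℚ
δ (suc i) (suc j) = δ i j

∑-δ : ∀ {k} (c : Fin k → ℚ) i → ∑[ j < k ] (c j * δ i j) ≡ c i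
∑-δ {suc k} c zero    = begin
    c zero * 1ℚ + ∑[ j < k ] (c (suc j) * 0ℚ)  ≡⟨ cong₂ _+_ (*-identityʳ (c zero)) (sum-cong-≗ (*-zeroʳ ∘ c ∘ suc)) ⟩
    c zero + ∑[ j < k ] 0ℚ                     ≡⟨ cong (c zero +_) (sum-replicate-zero k) ⟩
    c zero + 0ℚ                                ≡⟨ +-identityʳ (c zero) ⟩
    c zero                                     ∎
  where open ≡-Reasoning
∑-δ {suc k} c (suc i) = trans (cong₂ _+_ (*-zeroʳ (c zero)) (∑-δ (c ∘ suc) i)) (+-identityˡ (c (suc i)))

IsLeftInverse : ∀ {k m} → (Fin k → Fin m → ℚ) → (Fin k → ℕ → ℚ) → Set
IsLeftInverse {k} {m} A g = ∀ i j → ∑[ t < m ] (A i t * g j (toℕ t)) ≡ δ i j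

isLeftInverse? : ∀ {k m} (A : Fin k → Fin m → ℚ) g → Dec (IsLeftInverse A g)
isLeftInverse? {m = m} A g =
  Fin.all? λ i → Fin.all? λ j → ∑[ t < m ] (A i t * g j (toℕ t)) ≟ δ i j

leftInverse⇒linIndep : ∀ {k m} (A : Fin k → Fin m → ℚ) (g : Fin k → ℕ → ℚ) →
                       IsLeftInverse A g → LinIndep g
leftInverse⇒linIndep {k} {m} A g AG≡I c Σcg≡0 i = begin
    c i                                     ≡⟨ ∑-δ c i ⟨
    ∑[ j < k ] (c j * δ i j)                ≡⟨ sum-cong-≗ (λ j → cong (c j *_) (AG≡I i j)) ⟨
    ∑[ j < k ] (c j * ∑[ t < m ] AG j t)    ≡⟨ sum-cong-≗ (λ j → *-distribˡ-sum (c j) (AG j)) ⟩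
    ∑[ j < k ] ∑[ t < m ] (c j * AG j t)    ≡⟨ sum-cong-≗ (λ j → sum-cong-≗ (λ t → swap (c j) (A i t) _)) ⟩
    ∑[ j < k ] ∑[ t < m ] (A i t * cg t j)  ≡⟨ ∑-comm (λ j t → A i t * cg t j) ⟩
    ∑[ t < m ] ∑[ j < k ] (A i t * cg t j)  ≡⟨ sum-cong-≗ (λ t → *-distribˡ-sum (A i t) (cg t)) ⟨
    ∑[ t < m ] (A i t * ∑[ j < k ] cg t j)  ≡⟨ sum-cong-≗ (λ t → cong (A i t *_) (∑cg≡0 (toℕ t))) ⟩
    ∑[ t < m ] (A i t * 0ℚ)                 ≡⟨ sum-cong-≗ (*-zeroʳ ∘ A i) ⟩
    ∑[ t < m ] 0ℚ                           ≡⟨ sum-replicate-zero m ⟩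
    0ℚ                                      ∎
  where
  open ≡-Reasoning
  AG : Fin k → Fin m → ℚ
  AG j t = A i t * g j (toℕ t)
  cg : Fin m → Fin k → ℚ
  cg t j = c j * g j (toℕ t)
  swap : ∀ x y z → x * (y * z) ≡ y * (x * z)
  swap = solve 3 (λ x y z → x :* (y :* z) := y :* (x :* z)) refl
  ∑cg≡0 : ∀ n → ∑[ j < k ] (c j * g j n) ≡ 0ℚ
  ∑cg≡0 n = trans (sym (Σ<≡∑ k _)) (Σcg≡0 n)

fib-doubling : ∀ n → fib (2 ℕ.* n) ≡ fib-2n-form (fib n) (fib (suc n))
                   × fib (suc (2 ℕ.* n)) ≡ fib-2n+1-form (fib n) (fib (suc n))
fib-doubling zero    = refl , refl
fib-doubling (suc n) = even , odd
  where
  open ≡-Reasoning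
  x = fib n
  y = fib (suc n)
  F₂ₙ≡   = proj₁ (fib-doubling n)
  F₂ₙ₊₁≡ = proj₂ (fib-doubling n)

  even : fib (2 ℕ.* suc n) ≡ fib-2n-form y (y + x)
  even = begin
    fib (2 ℕ.* suc n)                    ≡⟨ cong fib (ℕ.*-suc 2 n) ⟩
    fib (suc (2 ℕ.* n)) + fib (2 ℕ.* n)  ≡⟨ cong₂ _+_ F₂ₙ₊₁≡ F₂ₙ≡ ⟩
    fib-2n+1-form x y + fib-2n-form x y  ≡⟨ step x y ⟩
    fib-2n-form y (y + x)                ∎
    where
    step : ∀ x y → fib-2n+1-form x y + fib-2n-form x y ≡ fib-2n-form y (y + x)
    step = solve 2 (λ x y → Poly.fib-2n+1-form x y :+ Poly.fib-2n-form x y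
                            := Poly.fib-2n-form y (y :+ x)) refl

  odd : fib (suc (2 ℕ.* suc n)) ≡ fib-2n+1-form y (y + x)
  odd = begin
    fib (suc (2 ℕ.* suc n))                                      ≡⟨ cong (fib ∘ suc) (ℕ.*-suc 2 n) ⟩
    fib (suc (2 ℕ.* n)) + fib (2 ℕ.* n) + fib (suc (2 ℕ.* n))    ≡⟨ cong₂ (λ a b → a + b + a) F₂ₙ₊₁≡ F₂ₙ≡ ⟩
    fib-2n+1-form x y + fib-2n-form x y + fib-2n+1-form x y      ≡⟨ step x y ⟩
    fib-2n+1-form y (y + x)                                      ∎
    where
    step : ∀ x y → fib-2n+1-form x y + fib-2n-form x y + fib-2n+1-form x y ≡ fib-2n+1-form y (y + x)
    step = solve 2 (λ x y → Poly.fib-2n+1-form x y :+ Poly.fib-2n-form x y :+ Poly.fib-2n+1-form x y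
                            := Poly.fib-2n+1-form y (y :+ x)) refl

fibConv : (ℕ → ℚ) → ℕ → ℕ → ℚ
fibConv a m k = ∑[ j < k ] (a (toℕ j) * fib (m ℕ.+ (k ℕ.∸ toℕ j)))

fibConv-fib : ∀ a m k → fibConv a (2 ℕ.+ m) k ≡ fibConv a (1 ℕ.+ m) k + fibConv a m k
fibConv-fib a m k = trans (sum-cong-≗ λ j → *-distribˡ-+ (a (toℕ j)) (F (suc m) j) (F m j))
                          (∑-distrib-+ (summand (suc m)) (summand m))
  where
  F : ℕ → Fin k → ℚ
  F m′ j = fib (m′ ℕ.+ (k ℕ.∸ toℕ j))
  summand : ℕ → Fin k → ℚ
  summand m′ j = a (toℕ j) * F m′ j

fibConv-suc : ∀ a m k → fibConv a m (suc k) ≡ fibConv a (suc m) k + a k * fib (suc m)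
fibConv-suc a m k = begin
    ∑[ j < suc k ] summand (toℕ j)                                ≡⟨ sum-init-last {k} (summand ∘ toℕ) ⟩
    ∑[ j < k ] summand (toℕ (inject₁ j)) + summand (toℕ (fromℕ k))  ≡⟨ cong₂ _+_ (sum-cong-≗ {k} init≡) last≡ ⟩
    fibConv a (suc m) k + a k * fib (suc m)                       ∎
  where
  open ≡-Reasoning
  summand : ℕ → ℚ
  summand j = a j * fib (m ℕ.+ (suc k ℕ.∸ j))

  index : ∀ {j} → j ℕ.≤ k → m ℕ.+ (suc k ℕ.∸ j) ≡ suc m ℕ.+ (k ℕ.∸ j)
  index j≤k = trans (cong (m ℕ.+_) (ℕ.+-∸-assoc 1 j≤k)) (ℕ.+-suc m _)

  init≡ : ∀ j → summand (toℕ (inject₁ j)) ≡ a (toℕ j) * fib (suc m ℕ.+ (k ℕ.∸ toℕ j))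
  init≡ j = begin
    summand (toℕ (inject₁ j))                    ≡⟨ cong summand (Fin.toℕ-inject₁ j) ⟩
    a (toℕ j) * fib (m ℕ.+ (suc k ℕ.∸ toℕ j))    ≡⟨ cong (λ i → a (toℕ j) * fib i) (index (ℕ.<⇒≤ (Fin.toℕ<n j))) ⟩
    a (toℕ j) * fib (suc m ℕ.+ (k ℕ.∸ toℕ j))    ∎

  last≡ : summand (toℕ (fromℕ k)) ≡ a k * fib (suc m)
  last≡ = begin
    summand (toℕ (fromℕ k))              ≡⟨ cong summand (Fin.toℕ-fromℕ k) ⟩
    a k * fib (m ℕ.+ (suc k ℕ.∸ k))      ≡⟨ cong (λ i → a k * fib i) (index ℕ.≤-refl) ⟩
    a k * fib (suc m ℕ.+ (k ℕ.∸ k))      ≡⟨ cong (λ i → a k * fib (suc m ℕ.+ i)) (ℕ.n∸n≡0 k) ⟩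
    a k * fib (suc m ℕ.+ 0)              ≡⟨ cong (λ i → a k * fib i) (ℕ.+-identityʳ (suc m)) ⟩
    a k * fib (suc m)                    ∎

fib² : ℕ → ℚ
fib² j = fib j ^ 2

fibConv-closed : ∀ n → fibConv fib² n n ≡ f-form (fib n) (fib (suc n))
                     × fibConv fib² (suc n) n ≡ f⁺-form (fib n) (fib (suc n))
fibConv-closed zero    = refl , refl
fibConv-closed (suc n) = diagonal , off-diagonal
  where
  x = fib n
  y = fib (suc n)
  C₀ = fibConv fib² n n
  C₁ = fibConv fib² (suc n) n
  C₀≡ = proj₁ (fibConv-closed n)
  C₁≡ = proj₂ (fibConv-closed n)
  open ≡-Reasoning

  diagonal : fibConv fib² (suc n) (suc n) ≡ f-form y (y + x)
  diagonal = begin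
    fibConv fib² (suc n) (suc n)              ≡⟨ fibConv-suc fib² (suc n) n ⟩
    fibConv fib² (2 ℕ.+ n) n + x ² * (y + x)  ≡⟨ cong (_+ x ² * (y + x)) (fibConv-fib fib² n n) ⟩
    C₁ + C₀ + x ² * (y + x)                   ≡⟨ cong₂ (λ c₁ c₀ → c₁ + c₀ + x ² * (y + x)) C₁≡ C₀≡ ⟩
    f⁺-form x y + f-form x y + x ² * (y + x)  ≡⟨ step x y ⟩
    f-form y (y + x)                          ∎
    where
    step : ∀ x y → f⁺-form x y + f-form x y + x ² * (y + x) ≡ f-form y (y + x)
    step = solve 2 (λ x y → Poly.f⁺-form x y :+ Poly.f-form x y :+ x Poly.² :* (y :+ x)
                            := Poly.f-form y (y :+ x)) refl

  off-diagonal : fibConv fib² (2 ℕ.+ n) (suc n) ≡ f⁺-form y (y + x)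
  off-diagonal = begin
    fibConv fib² (2 ℕ.+ n) (suc n)                              ≡⟨ fibConv-suc fib² (2 ℕ.+ n) n ⟩
    fibConv fib² (3 ℕ.+ n) n + x ² * (y + x + y)                ≡⟨ cong (_+ x ² * (y + x + y)) recurrence ⟩
    C₁ + C₀ + C₁ + x ² * (y + x + y)                            ≡⟨ cong (_+ x ² * (y + x + y)) IH ⟩
    f⁺-form x y + f-form x y + f⁺-form x y + x ² * (y + x + y)  ≡⟨ step x y ⟩
    f⁺-form y (y + x)                                           ∎
    where
    recurrence : fibConv fib² (3 ℕ.+ n) n ≡ C₁ + C₀ + C₁
    recurrence = trans (fibConv-fib fib² (suc n) n) (cong (_+ C₁) (fibConv-fib fib² n n))
    IH : C₁ + C₀ + C₁ ≡ f⁺-form x y + f-form x y + f⁺-form x y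
    IH = cong₂ (λ c₁ c₀ → c₁ + c₀ + c₁) C₁≡ C₀≡
    step : ∀ x y → f⁺-form x y + f-form x y + f⁺-form x y + x ² * (y + x + y) ≡ f⁺-form y (y + x)
    step = solve 2 (λ x y → Poly.f⁺-form x y :+ Poly.f-form x y :+ Poly.f⁺-form x y
                              :+ x Poly.² :* (y :+ x :+ y)
                            := Poly.f⁺-form y (y :+ x)) refl

f≡fibConv : ∀ n → f n ≡ fibConv fib² n n
f≡fibConv n = trans (Σ<≡∑ n _) (sum-cong-≗ λ j →
  cong (λ i → fib² (toℕ j) * fib i) (index (ℕ.<⇒≤ (Fin.toℕ<n j))))
  where
  index : ∀ {j} → j ℕ.≤ n → 2 ℕ.* n ℕ.∸ j ≡ n ℕ.+ (n ℕ.∸ j)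
  index {j} j≤n = trans (cong (λ i → n ℕ.+ i ℕ.∸ j) (ℕ.+-identityʳ n)) (ℕ.+-∸-assoc n j≤n)

f≡f-form : ∀ n → f n ≡ f-form (fib n) (fib (suc n))
f≡f-form n = trans (f≡fibConv n) (proj₁ (fibConv-closed n))

f≡lincomb-family1 : ∀ n → f n ≡ lincomb coeffs1 family1 n
f≡lincomb-family1 n = trans (f≡f-form n)
  (identity (fib n) (fib (suc n)) (nℚ n) (proj₁ (fib-doubling n)) (proj₂ (fib-doubling n)))
  where
  identity : ∀ x y t {u v} → u ≡ fib-2n-form x y → v ≡ fib-2n+1-form x y →
             f-form x y ≡ combination₁ x y t u v
  identity x y t refl refl = solve 3 (λ x y t → Poly.f-form x y
    := Poly.combination₁ x y t (Poly.fib-2n-form x y) (Poly.fib-2n+1-form x y)) refl x y t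

f≡lincomb-family2 : ∀ n → f n ≡ lincomb coeffs2 family2 n
f≡lincomb-family2 n = trans (f≡f-form n) (identity (fib n) (fib (suc n)) (nℚ n))
  where
  identity : ∀ x y t → f-form x y ≡ combination₂ x y t
  identity = solve 3 (λ x y t → Poly.f-form x y := Poly.combination₂ x y t) refl

module LeftInverses where

  open import Agda.Builtin.FromNat using (fromNat)
  open import Agda.Builtin.FromNeg using (fromNeg)
  open import Data.Unit using (tt)

  instance
    ℕ-number : Number ℕ
    ℕ-number = ℕ.number

    ℤ-number : Number ℤ
    ℤ-number = ℤ.number

    ℤ-negative : Negative ℤ
    ℤ-negative = ℤ.negative

  -- 2420 and 24200 times the inverses of the value matrices (family j at n = t), found by
  -- Gauss–Jordan elimination.
  family1-leftInverse : Fin 8 → Fin 8 → ℚ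
  family1-leftInverse i t = lookup (lookup rows i) t / 2420
    where
    rows : Vec (Vec ℤ 8) 8
    rows =
        (4774 ∷ -1826 ∷ -66836 ∷ 111496 ∷ -13772 ∷ -35948 ∷ 15730 ∷ -1826 ∷ [])
      ∷ (1187 ∷ -12938 ∷ -44558 ∷ 129348 ∷ -28486 ∷ -39074 ∷ 18865 ∷ -2268 ∷ [])
      ∷ (-2948 ∷ 1122 ∷ 41272 ∷ -68772 ∷ 8404 ∷ 22176 ∷ -9680 ∷ 1122 ∷ [])
      ∷ (-745 ∷ 8025 ∷ 27700 ∷ -80550 ∷ 18050 ∷ 24360 ∷ -11825 ∷ 1425 ∷ [])
      ∷ (1470 ∷ 13445 ∷ -109350 ∷ 184510 ∷ -24360 ∷ -60970 ∷ 27060 ∷ -3165 ∷ [])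
      ∷ (6475 ∷ -37650 ∷ 62580 ∷ -16790 ∷ -17760 ∷ 11960 ∷ -2585 ∷ 190 ∷ [])
      ∷ (-9685 ∷ 31120 ∷ 47920 ∷ -190470 ∷ 49520 ∷ 55320 ∷ -27885 ∷ 3400 ∷ [])
      ∷ (3165 ∷ -8025 ∷ -27700 ∷ 80550 ∷ -18050 ∷ -24360 ∷ 11825 ∷ -1425 ∷ [])
      ∷ []

  family2-leftInverse : Fin 10 → Fin 10 → ℚ
  family2-leftInverse i t = lookup (lookup rows i) t / 24200
    where
    rows : Vec (Vec ℤ 10) 10
    rows =
        (-29575 ∷ 246900 ∷ -456800 ∷ -546525 ∷ 1367500 ∷ 694300 ∷ -747725 ∷ -101800 ∷ 139100 ∷ -20375 ∷ [])
      ∷ (90050 ∷ -436200 ∷ 248300 ∷ 1139500 ∷ -824800 ∷ -917200 ∷ 556050 ∷ 146800 ∷ -120500 ∷ 16200 ∷ [])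
      ∷ (-77325 ∷ 256100 ∷ 214950 ∷ -778375 ∷ -545900 ∷ 330800 ∷ 170225 ∷ -61800 ∷ -11750 ∷ 3475 ∷ [])
      ∷ (20375 ∷ -49950 ∷ -119850 ∷ 174825 ∷ 329600 ∷ -18000 ∷ -141075 ∷ 6150 ∷ 20450 ∷ -3525 ∷ [])
      ∷ (13097 ∷ 123756 ∷ 267028 ∷ -301861 ∷ -926708 ∷ -93788 ∷ 438691 ∷ 6848 ∷ -69976 ∷ 11377 ∷ [])
      ∷ (-14309 ∷ -157292 ∷ -358486 ∷ 468847 ∷ 1104676 ∷ 29976 ∷ -497827 ∷ 5464 ∷ 76062 ∷ -12679 ∷ [])
      ∷ (3825 ∷ 49950 ∷ 119850 ∷ -174825 ∷ -329600 ∷ 18000 ∷ 141075 ∷ -6150 ∷ -20450 ∷ 3525 ∷ [])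
      ∷ (-40678 ∷ -64944 ∷ 560428 ∷ 192214 ∷ -1204808 ∷ -391688 ∷ 586366 ∷ 50248 ∷ -100276 ∷ 15202 ∷ [])
      ∷ (49742 ∷ 81356 ∷ -684112 ∷ -262966 ∷ 1491512 ∷ 518672 ∷ -737374 ∷ -69652 ∷ 128304 ∷ -19338 ∷ [])
      ∷ (-15202 ∷ -25476 ∷ 208692 ∷ 89166 ∷ -461472 ∷ -171072 ∷ 231594 ∷ 23892 ∷ -40964 ∷ 6138 ∷ [])
      ∷ []

family1-linIndep : LinIndep family1
family1-linIndep = leftInverse⇒linIndep A family1 (from-yes (isLeftInverse? A family1))
  where A = LeftInverses.family1-leftInverse

family2-linIndep : LinIndep family2
family2-linIndep = leftInverse⇒linIndep A family2 (from-yes (isLeftInverse? A family2))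
  where A = LeftInverses.family2-leftInverse

corollary13 : (LinIndep family1 × UniqueExpr family1 f coeffs1)
    × (LinIndep family2 × UniqueExpr family2 f coeffs2)
corollary13 =
  (family1-linIndep , linIndep⇒uniqueExpr family1 family1-linIndep f≡lincomb-family1) ,
  (family2-linIndep , linIndep⇒uniqueExpr family2 family2-linIndep f≡lincomb-family2)
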